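{- Let $G$ be a finite group with identity $e$ and let $S\subseteq G\setminus\{e\}$ be a union of conjugacy classes of $G$ (equivalently, $\overline{S}=\sum_{s\in S}s$ lies in the center of $\mathbb{Z}[G]$). Then the Cayley graph $\mathcal{C}(G,S)$ is not a directed strongly regular graph with parameters $(n,k,\mu,\lambda,t)$ satisfying $0<t<k$.
   Context: For $S\subseteq G\setminus\{e\}$, the Cayley graph $\mathcal{C}(G,S)$ has vertex set $G$ and an arc $x\to y$ iff $yx^{ -1}\in S$. A directed graph on $n$ vertices with $0/1$ adjacency matrix $A$ (zero diagonal) is a directed strongly regular graph (DSRG) with parameters $(n,k,\mu,\lambda,t)$ if $JA=AJ=kJ$ and $A^2=tI+\lambda A+\mu(J-I-A)$, where $I$ is the identity and $J$ the all-ones $n\times n$ matrix. -}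

module Defs where

open import Data.Nat using (ℕ; zero; suc; _+_; _*_; _∸_)
open import Data.Fin using (Fin)
open import Data.Fin.Subset using (Subset; _∈_; _∉_)
open import Data.List using (tabulate)
open import Data.Nat.ListAction using (sum)
open import Data.Bool using (Bool; true; false; if_then_else_)
open import Relation.Nullary using (does)
open import Relation.Binary.PropositionalEquality using (_≡_)
open import Data.Fin.Properties using (_≟_)
open import Data.Vec using (lookup)
open import Data.Sum using (_⊎_)

∑ : {n : ℕ} → (Fin n → ℕ) → ℕ
∑ f = sum (tabulate f)

Mat : ℕ → Set
Mat n = Fin n → Fin n → ℕ

I : {n : ℕ} → Mat n
I i j = if does (i ≟ j) then 1 else 0

J : {n : ℕ} → Mat n
J i j = 1

_·_ : {n : ℕ} → Mat n → Mat n → Mat n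
(A · B) i j = ∑ (λ l → A i l * B l j)

ZeroOne : {n : ℕ} → Mat n → Set
ZeroOne A = ∀ i j → (A i j ≡ 0) ⊎ (A i j ≡ 1)

-- directed strongly regular graph with parameters (n,k,μ,λ,t):
-- A is 0/1 with zero diagonal, JA = AJ = kJ,
-- A² = tI + λA + μ(J - I - A)   (entrywise; J - I - A has entries 1 ∸ I ∸ A,
-- which is exact in ℕ since A has zero diagonal and 0/1 entries)
record IsDSRG (n : ℕ) (A : Mat n) (k μ lam t : ℕ) : Set where
  field
    zeroOne  : ZeroOne A
    zeroDiag : ∀ i → A i i ≡ 0
    JA≡kJ    : ∀ i j → (J · A) i j ≡ k * J i j
    AJ≡kJ    : ∀ i j → (A · J) i j ≡ k * J i j
    A²       : ∀ i j → (A · A) i j ≡ t * I i j + lam * A i j + μ * (J i j ∸ I i j ∸ A i j)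

cayley : {n : ℕ} (_∙_ : Fin n → Fin n → Fin n) (_⁻¹ : Fin n → Fin n) →
         Subset n → Mat n
cayley _∙_ _⁻¹ S x y = if lookup S (y ∙ (x ⁻¹)) then 1 else 0

module Submission where

open import Defs
open import Data.Nat using (ℕ; _<_)
open import Data.Fin using (Fin)
open import Data.Fin.Subset using (Subset; _∈_; _∉_)
open import Data.Product using (_×_)
open import Relation.Nullary using (¬_)
open import Relation.Binary.PropositionalEquality using (_≡_)
open import Algebra.Structures using (IsGroup)

import Data.Integer.Properties as ZP
import Data.Nat.Properties as NP
open import Algebra.Bundles using (Group)
import Algebra.Properties.CommutativeMonoid.Sum as CommutativeMonoidSum
open import Algebra.Properties.CommutativeSemigroup ZP.*-commutativeSemigroup using (x∙yz≈y∙xz)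
import Algebra.Properties.Group as GroupProperties
open import Algebra.Properties.Semiring.Sum ZP.+-*-semiring
  using (sum; sum-cong-≗; sum-replicate-zero; ∑-distrib-+; ∑-comm; *-distribˡ-sum; *-distribʳ-sum)
open import Data.Bool using (true; false; if_then_else_)
open import Data.Empty using (⊥; ⊥-elim)
open import Data.Fin using (zero; suc)
open import Data.Fin.Permutation using (Permutation′; _⟨$⟩ʳ_; permutation)
open import Data.Fin.Properties using (_≟_; ¬Fin0)
open import Data.Integer as ℤ using (ℤ; +_; +[1+_]; -[1+_]; 0ℤ; 1ℤ; -1ℤ; _+_; _-_; -_; _*_; ∣_∣; +≤+; -≤+)
open import Data.Integer.Tactic.RingSolver using (solve-∀)
open import Data.Nat as ℕ using (zero; suc; z≤n; s≤s; _≤_)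
import Data.Nat.Tactic.RingSolver as ℕ-Solver
open import Data.Product using (∃; _,_)
open import Data.Sum using (_⊎_; inj₁; inj₂)
open import Data.Vec using (lookup)
open import Data.Vec.Properties using ([]=⇒lookup; lookup⇒[]=)
open import Function using (_∘_)
open import Relation.Nullary using (yes; no)
open import Relation.Binary.PropositionalEquality
  using (refl; sym; trans; cong; cong₂; subst; subst₂; module ≡-Reasoning)

-- Because S is closed under conjugation, l ↦ i l⁻¹ j is a bijection from the common
-- out-neighbours of i and j onto their common in-neighbours, so A Aᵀ = Aᵀ A.
-- Write A² = τI + cA + μJ with τ = t − μ, c = λ − μ, and put D = A − Aᵀ,
-- P = A + Aᵀ − cI.  Normality gives DP = PD = 0, DJ = 0 and
-- D² + P² = αI + 4μJ with α = c² + 4τ, hence (D²)² = αD².  Since D² is symmetric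
-- and D skew, comparing diagonal entries at a vertex e gives
-- Σₗ (D²)ₑₗ² = −α Σₗ Dₑₗ²; an unreciprocated arc out of e (it exists as t < k) makes
-- the right-hand sum positive, so α ≤ 0.  The same computation for Q = nP − ρJ,
-- where ρ = 2k − c is the row sum of P so that QJ = 0, gives
-- Σₗ (Q²)ₑₗ² = n²α Σₗ Qₑₗ² ≤ 0, so row e of Q vanishes.
-- But Q takes values differing by exactly n at a reciprocated out-neighbour of e
-- (it exists as t > 0) and at an unreciprocated one, so n = 0: there is no vertex.

-- Finite sums

module ℕ-Sum = CommutativeMonoidSum NP.+-0-commutativeMonoid

∑≡sum : ∀ {n} (f : Fin n → ℕ) → ∑ f ≡ ℕ-Sum.sum f
∑≡sum {zero}  f = refl
∑≡sum {suc n} f = cong (f zero ℕ.+_) (∑≡sum (f ∘ suc))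

∑-cong : ∀ {n} {f g : Fin n → ℕ} → (∀ l → f l ≡ g l) → ∑ f ≡ ∑ g
∑-cong {f = f} {g} f≗g = trans (∑≡sum f) (trans (ℕ-Sum.sum-cong-≗ f≗g) (sym (∑≡sum g)))

∑-permute : ∀ {n} (f : Fin n → ℕ) (π : Permutation′ n) → ∑ f ≡ ∑ (f ∘ (π ⟨$⟩ʳ_))
∑-permute f π = trans (∑≡sum f) (trans (ℕ-Sum.∑-permute f π) (sym (∑≡sum (f ∘ (π ⟨$⟩ʳ_)))))

∑-ones : ∀ n → ∑ {n} (λ _ → 1) ≡ n
∑-ones zero    = refl
∑-ones (suc n) = cong suc (∑-ones n)

term≤∑ : ∀ {n} (f : Fin n → ℕ) l → f l ≤ ∑ f
term≤∑ f zero    = NP.m≤m+n _ _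
term≤∑ f (suc l) = NP.≤-trans (term≤∑ (f ∘ suc) l) (NP.m≤n+m _ (f zero))

∑≡0⇒≡0 : ∀ {n} (f : Fin n → ℕ) → ∑ f ≡ 0 → ∀ l → f l ≡ 0
∑≡0⇒≡0 f ∑f≡0 l = NP.n≤0⇒n≡0 (NP.≤-trans (term≤∑ f l) (NP.≤-reflexive ∑f≡0))

0<∑⇒∃0< : ∀ {n} (f : Fin n → ℕ) → 0 < ∑ f → ∃ λ l → 0 < f l
0<∑⇒∃0< {suc n} f 0<∑ with f zero in eq
... | suc _ = zero , NP.≤-trans (s≤s z≤n) (NP.≤-reflexive (sym eq))
... | zero with 0<∑⇒∃0< (f ∘ suc) 0<∑
...   | l , 0<fl = suc l , 0<fl

∑<∑⇒∃< : ∀ {n} (f g : Fin n → ℕ) → (∀ l → f l ≤ g l) → ∑ f < ∑ g → ∃ λ l → f l < g l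
∑<∑⇒∃< {suc n} f g f≤g ∑f<∑g with f zero ℕ.<? g zero
... | yes f₀<g₀ = zero , f₀<g₀
... | no f₀≮g₀ with ∑<∑⇒∃< (f ∘ suc) (g ∘ suc) (f≤g ∘ suc) (NP.+-cancelˡ-< (g zero) _ _ tails<)
  where
  tails< : g zero ℕ.+ ∑ (f ∘ suc) < g zero ℕ.+ ∑ (g ∘ suc)
  tails< = subst (λ x → x ℕ.+ ∑ (f ∘ suc) < _) (NP.≤-antisym (f≤g zero) (NP.≮⇒≥ f₀≮g₀)) ∑f<∑g
...   | l , fl<gl = suc l , fl<gl

pos-∑ : ∀ {n} (f : Fin n → ℕ) → + ∑ f ≡ sum (+_ ∘ f)
pos-∑ {zero}  f = refl
pos-∑ {suc n} f = trans (ZP.pos-+ (f zero) _) (cong (_+_ (+ f zero)) (pos-∑ (f ∘ suc)))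

sum-neg : ∀ {n} (f : Fin n → ℤ) → sum (λ l → - f l) ≡ - sum f
sum-neg f = begin
  sum (λ l → - f l)     ≡⟨ sum-cong-≗ (λ l → sym (ZP.-1*i≡-i (f l))) ⟩
  sum (λ l → -1ℤ * f l) ≡⟨ *-distribˡ-sum -1ℤ f ⟨
  -1ℤ * sum f           ≡⟨ ZP.-1*i≡-i (sum f) ⟩
  - sum f               ∎
  where open ≡-Reasoning

I-sym : ∀ {n} (i j : Fin n) → I i j ≡ I j i
I-sym i j with i ≟ j | j ≟ i
... | yes _   | yes _   = refl
... | no  _   | no  _   = refl
... | yes i≡j | no  j≢i = ⊥-elim (j≢i (sym i≡j))
... | no  i≢j | yes j≡i = ⊥-elim (i≢j (sym j≡i))

I-diag : ∀ {n} (i : Fin n) → I i i ≡ 1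
I-diag i with i ≟ i
... | yes _  = refl
... | no i≢i = ⊥-elim (i≢i refl)

sum-δ : ∀ {n} (f : Fin n → ℤ) j → sum (λ l → f l * + I l j) ≡ f j
sum-δ {suc n} f zero = begin
  f zero * 1ℤ + sum (λ l → f (suc l) * 0ℤ) ≡⟨ cong₂ _+_ (ZP.*-identityʳ (f zero)) (sum-cong-≗ (ZP.*-zeroʳ ∘ f ∘ suc)) ⟩
  f zero + sum {n} (λ _ → 0ℤ)              ≡⟨ cong (_+_ (f zero)) (sum-replicate-zero n) ⟩
  f zero + 0ℤ                              ≡⟨ ZP.+-identityʳ (f zero) ⟩
  f zero                                   ∎
  where open ≡-Reasoning
sum-δ {suc n} f (suc j) = begin
  f zero * 0ℤ + sum (λ l → f (suc l) * + I l j) ≡⟨ cong₂ _+_ (ZP.*-zeroʳ (f zero)) (sum-δ (f ∘ suc) j) ⟩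
  0ℤ + f (suc j)                                ≡⟨ ZP.+-identityˡ (f (suc j)) ⟩
  f (suc j)                                     ∎
  where open ≡-Reasoning

-- Integer arithmetic

pos-linear₃ : ∀ p q r x y z → + (p ℕ.* x ℕ.+ q ℕ.* y ℕ.+ r ℕ.* z) ≡ + p * + x + + q * + y + + r * + z
pos-linear₃ p q r x y z = begin
  + (p ℕ.* x ℕ.+ q ℕ.* y ℕ.+ r ℕ.* z)     ≡⟨ ZP.pos-+ (p ℕ.* x ℕ.+ q ℕ.* y) (r ℕ.* z) ⟩
  + (p ℕ.* x ℕ.+ q ℕ.* y) + + (r ℕ.* z)   ≡⟨ cong (_+ + (r ℕ.* z)) (ZP.pos-+ (p ℕ.* x) (q ℕ.* y)) ⟩
  + (p ℕ.* x) + + (q ℕ.* y) + + (r ℕ.* z) ≡⟨ cong₂ _+_ (cong₂ _+_ (ZP.pos-* p x) (ZP.pos-* q y)) (ZP.pos-* r z) ⟩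
  + p * + x + + q * + y + + r * + z       ∎
  where open ≡-Reasoning

1∸δ∸a≡1-δ-a : ∀ {δ a} → (δ ≡ 1 × a ≡ 0) ⊎ (δ ≡ 0 × (a ≡ 0 ⊎ a ≡ 1)) →
              + (1 ℕ.∸ δ ℕ.∸ a) ≡ 1ℤ - + δ - + a
1∸δ∸a≡1-δ-a (inj₁ (refl , refl))      = refl
1∸δ∸a≡1-δ-a (inj₂ (refl , inj₁ refl)) = refl
1∸δ∸a≡1-δ-a (inj₂ (refl , inj₂ refl)) = refl

i*i≡+∣i∣*∣i∣ : ∀ i → i * i ≡ + (∣ i ∣ ℕ.* ∣ i ∣)
i*i≡+∣i∣*∣i∣ (+ m)    = sym (ZP.pos-* m m)
i*i≡+∣i∣*∣i∣ -[1+ m ] = refl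

*-neg≥0⇒≤0 : ∀ {m p} a → 0 < p → + m ≡ a * - + p → a ℤ.≤ 0ℤ
*-neg≥0⇒≤0 (+ zero) _       _  = +≤+ z≤n
*-neg≥0⇒≤0 +[1+ _ ] (s≤s _) ()
*-neg≥0⇒≤0 -[1+ _ ] _       _  = -≤+

≤0*+≡+⇒≡0 : ∀ {m p a} → a ℤ.≤ 0ℤ → + m ≡ a * + p → m ≡ 0
≤0*+≡+⇒≡0 {a = + zero}                _        eq = ZP.+-injective eq
≤0*+≡+⇒≡0 {p = zero}  {a = -[1+ a ]}  _        eq = ZP.+-injective (trans eq (ZP.*-zeroʳ -[1+ a ]))
≤0*+≡+⇒≡0 {p = suc _} {a = -[1+ _ ]}  _        ()
≤0*+≡+⇒≡0 {a = +[1+ _ ]}              (+≤+ ()) _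

≤0*square≤0 : ∀ {a} b → a ℤ.≤ 0ℤ → a * (b * b) ℤ.≤ 0ℤ
≤0*square≤0 {a} b a≤0 = begin
  a * (b * b)               ≡⟨ cong (a *_) (i*i≡+∣i∣*∣i∣ b) ⟩
  a * + (∣ b ∣ ℕ.* ∣ b ∣)   ≤⟨ ZP.*-monoʳ-≤-nonNeg (+ (∣ b ∣ ℕ.* ∣ b ∣)) a≤0 ⟩
  0ℤ * + (∣ b ∣ ℕ.* ∣ b ∣)  ≡⟨ ZP.*-zeroˡ (+ (∣ b ∣ ℕ.* ∣ b ∣)) ⟩
  0ℤ                        ∎
  where open ZP.≤-Reasoning

0<x*y⇒x≡1×y≡1 : ∀ {x y} → x ≡ 0 ⊎ x ≡ 1 → y ≡ 0 ⊎ y ≡ 1 → 0 < x ℕ.* y → x ≡ 1 × y ≡ 1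
0<x*y⇒x≡1×y≡1 (inj₁ refl) _           ()
0<x*y⇒x≡1×y≡1 (inj₂ refl) (inj₁ refl) ()
0<x*y⇒x≡1×y≡1 (inj₂ refl) (inj₂ refl) _ = refl , refl

x*y<x*1⇒x≡1×y≡0 : ∀ {x y} → x ≡ 0 ⊎ x ≡ 1 → y ≡ 0 ⊎ y ≡ 1 → x ℕ.* y < x ℕ.* 1 → x ≡ 1 × y ≡ 0
x*y<x*1⇒x≡1×y≡0 (inj₁ refl) _           ()
x*y<x*1⇒x≡1×y≡0 (inj₂ refl) (inj₁ refl) _   = refl , refl
x*y<x*1⇒x≡1×y≡0 (inj₂ refl) (inj₂ refl) 1<1 = ⊥-elim (NP.<-irrefl refl 1<1)

x*y≤x*1 : ∀ x {y} → y ≡ 0 ⊎ y ≡ 1 → x ℕ.* y ≤ x ℕ.* 1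
x*y≤x*1 x (inj₁ refl) = NP.*-monoʳ-≤ x z≤n
x*y≤x*1 x (inj₂ refl) = NP.≤-refl

-- Integer matrices

infix 30 _ᵀ

_ᵀ : ∀ {n} {R : Set} → (Fin n → Fin n → R) → Fin n → Fin n → R
(X ᵀ) i j = X j i

Matrix : ℕ → Set
Matrix n = Fin n → Fin n → ℤ

module _ {n : ℕ} where

  infixl 7 _⊗_
  infixr 7 _⊙_
  infixl 6 _⊕_
  infix  4 _≈_

  _⊗_ : Matrix n → Matrix n → Matrix n
  (X ⊗ Y) i j = sum λ l → X i l * Y l j

  _⊕_ : Matrix n → Matrix n → Matrix n
  (X ⊕ Y) i j = X i j + Y i j

  _⊙_ : ℤ → Matrix n → Matrix n
  (a ⊙ X) i j = a * X i j

  𝟘 𝐈 𝐉 : Matrix n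
  𝟘 i j = 0ℤ
  𝐈 i j = + I i j
  𝐉 i j = 1ℤ

  _≈_ : Matrix n → Matrix n → Set
  X ≈ Y = ∀ i j → X i j ≡ Y i j

  toℤ : Mat n → Matrix n
  toℤ X i j = + X i j

  toℤ-· : ∀ X Y → toℤ (X · Y) ≈ toℤ X ⊗ toℤ Y
  toℤ-· X Y i j = trans (pos-∑ λ l → X i l ℕ.* Y l j) (sum-cong-≗ λ l → ZP.pos-* (X i l) (Y l j))

  ⊕-comm : ∀ X Y → X ⊕ Y ≈ Y ⊕ X
  ⊕-comm X Y i j = ZP.+-comm (X i j) (Y i j)

  ⊗-congʳ : ∀ X {Y Y′} → Y ≈ Y′ → X ⊗ Y ≈ X ⊗ Y′
  ⊗-congʳ X Y≈Y′ i j = sum-cong-≗ λ l → cong (X i l *_) (Y≈Y′ l j)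

  ⊗-assoc : ∀ X Y Z → (X ⊗ Y) ⊗ Z ≈ X ⊗ (Y ⊗ Z)
  ⊗-assoc X Y Z i j = begin
    sum (λ l → sum (λ m → X i m * Y m l) * Z l j)
      ≡⟨ sum-cong-≗ (λ l → *-distribʳ-sum (Z l j) (λ m → X i m * Y m l)) ⟩
    sum (λ l → sum (λ m → X i m * Y m l * Z l j))
      ≡⟨ ∑-comm (λ l m → X i m * Y m l * Z l j) ⟩
    sum (λ m → sum (λ l → X i m * Y m l * Z l j))
      ≡⟨ sum-cong-≗ (λ m → sum-cong-≗ λ l → ZP.*-assoc (X i m) (Y m l) (Z l j)) ⟩
    sum (λ m → sum (λ l → X i m * (Y m l * Z l j)))
      ≡⟨ sum-cong-≗ (λ m → *-distribˡ-sum (X i m) (λ l → Y m l * Z l j)) ⟨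
    sum (λ m → X i m * sum (λ l → Y m l * Z l j))
      ∎
    where open ≡-Reasoning

  ⊗-transpose : ∀ X Y → (X ⊗ Y) ᵀ ≈ Y ᵀ ⊗ X ᵀ
  ⊗-transpose X Y i j = sum-cong-≗ λ l → ZP.*-comm (X j l) (Y l i)

  ⊗-distribʳ-⊕ : ∀ X Y Z → (X ⊕ Y) ⊗ Z ≈ X ⊗ Z ⊕ Y ⊗ Z
  ⊗-distribʳ-⊕ X Y Z i j = trans (sum-cong-≗ λ l → ZP.*-distribʳ-+ (Z l j) (X i l) (Y i l))
                                 (∑-distrib-+ (λ l → X i l * Z l j) (λ l → Y i l * Z l j))

  ⊗-distribˡ-⊕ : ∀ X Y Z → X ⊗ (Y ⊕ Z) ≈ X ⊗ Y ⊕ X ⊗ Z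
  ⊗-distribˡ-⊕ X Y Z i j = trans (sum-cong-≗ λ l → ZP.*-distribˡ-+ (X i l) (Y l j) (Z l j))
                                 (∑-distrib-+ (λ l → X i l * Y l j) (λ l → X i l * Z l j))

  ⊙-⊗ : ∀ a X Y → (a ⊙ X) ⊗ Y ≈ a ⊙ (X ⊗ Y)
  ⊙-⊗ a X Y i j = trans (sum-cong-≗ λ l → ZP.*-assoc a (X i l) (Y l j))
                        (sym (*-distribˡ-sum a (λ l → X i l * Y l j)))

  ⊗-⊙ : ∀ a X Y → X ⊗ (a ⊙ Y) ≈ a ⊙ (X ⊗ Y)
  ⊗-⊙ a X Y i j = trans (sum-cong-≗ λ l → x∙yz≈y∙xz (X i l) a (Y l j))
                        (sym (*-distribˡ-sum a (λ l → X i l * Y l j)))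

  ⊗-identityʳ : ∀ X → X ⊗ 𝐈 ≈ X
  ⊗-identityʳ X i j = sum-δ (X i) j

  ⊗-identityˡ : ∀ X → 𝐈 ⊗ X ≈ X
  ⊗-identityˡ X i j =
    trans (sum-cong-≗ λ l → trans (ZP.*-comm (+ I i l) (X l j)) (cong (λ d → X l j * + d) (I-sym i l)))
          (sum-δ (λ l → X l j) i)

  ⊗-zeroʳ : ∀ X {Y} → Y ≈ 𝟘 → X ⊗ Y ≈ 𝟘
  ⊗-zeroʳ X {Y} Y≈𝟘 i j = begin
    sum (λ l → X i l * Y l j) ≡⟨ sum-cong-≗ (λ l → trans (cong (X i l *_) (Y≈𝟘 l j)) (ZP.*-zeroʳ (X i l))) ⟩
    sum {n} (λ _ → 0ℤ)        ≡⟨ sum-replicate-zero n ⟩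
    0ℤ                        ∎
    where open ≡-Reasoning

  ⊗-zeroˡ : ∀ {X} Y → X ≈ 𝟘 → X ⊗ Y ≈ 𝟘
  ⊗-zeroˡ {X} Y X≈𝟘 i j = begin
    sum (λ l → X i l * Y l j) ≡⟨ sum-cong-≗ (λ l → trans (cong (_* Y l j) (X≈𝟘 i l)) (ZP.*-zeroˡ (Y l j))) ⟩
    sum {n} (λ _ → 0ℤ)        ≡⟨ sum-replicate-zero n ⟩
    0ℤ                        ∎
    where open ≡-Reasoning

  comb-⊗ : ∀ a b c d P Q R T Y i j →
           ((a ⊙ P ⊕ b ⊙ Q ⊕ c ⊙ R ⊕ d ⊙ T) ⊗ Y) i j ≡
           a * (P ⊗ Y) i j + b * (Q ⊗ Y) i j + c * (R ⊗ Y) i j + d * (T ⊗ Y) i j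
  comb-⊗ a b c d P Q R T Y i j = begin
    ((a ⊙ P ⊕ b ⊙ Q ⊕ c ⊙ R ⊕ d ⊙ T) ⊗ Y) i j
      ≡⟨ ⊗-distribʳ-⊕ (a ⊙ P ⊕ b ⊙ Q ⊕ c ⊙ R) (d ⊙ T) Y i j ⟩
    ((a ⊙ P ⊕ b ⊙ Q ⊕ c ⊙ R) ⊗ Y) i j + ((d ⊙ T) ⊗ Y) i j
      ≡⟨ cong (_+ ((d ⊙ T) ⊗ Y) i j) (⊗-distribʳ-⊕ (a ⊙ P ⊕ b ⊙ Q) (c ⊙ R) Y i j) ⟩
    ((a ⊙ P ⊕ b ⊙ Q) ⊗ Y) i j + ((c ⊙ R) ⊗ Y) i j + ((d ⊙ T) ⊗ Y) i j
      ≡⟨ cong (λ u → u + ((c ⊙ R) ⊗ Y) i j + ((d ⊙ T) ⊗ Y) i j) (⊗-distribʳ-⊕ (a ⊙ P) (b ⊙ Q) Y i j) ⟩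
    ((a ⊙ P) ⊗ Y) i j + ((b ⊙ Q) ⊗ Y) i j + ((c ⊙ R) ⊗ Y) i j + ((d ⊙ T) ⊗ Y) i j
      ≡⟨ cong₂ _+_ (cong₂ _+_ (cong₂ _+_ (⊙-⊗ a P Y i j) (⊙-⊗ b Q Y i j)) (⊙-⊗ c R Y i j)) (⊙-⊗ d T Y i j) ⟩
    a * (P ⊗ Y) i j + b * (Q ⊗ Y) i j + c * (R ⊗ Y) i j + d * (T ⊗ Y) i j
      ∎
    where open ≡-Reasoning

  ⊗-comb : ∀ a b c d P Q R T X i j →
           (X ⊗ (a ⊙ P ⊕ b ⊙ Q ⊕ c ⊙ R ⊕ d ⊙ T)) i j ≡
           a * (X ⊗ P) i j + b * (X ⊗ Q) i j + c * (X ⊗ R) i j + d * (X ⊗ T) i j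
  ⊗-comb a b c d P Q R T X i j = begin
    (X ⊗ (a ⊙ P ⊕ b ⊙ Q ⊕ c ⊙ R ⊕ d ⊙ T)) i j
      ≡⟨ ⊗-distribˡ-⊕ X (a ⊙ P ⊕ b ⊙ Q ⊕ c ⊙ R) (d ⊙ T) i j ⟩
    (X ⊗ (a ⊙ P ⊕ b ⊙ Q ⊕ c ⊙ R)) i j + (X ⊗ (d ⊙ T)) i j
      ≡⟨ cong (_+ (X ⊗ (d ⊙ T)) i j) (⊗-distribˡ-⊕ X (a ⊙ P ⊕ b ⊙ Q) (c ⊙ R) i j) ⟩
    (X ⊗ (a ⊙ P ⊕ b ⊙ Q)) i j + (X ⊗ (c ⊙ R)) i j + (X ⊗ (d ⊙ T)) i j
      ≡⟨ cong (λ u → u + (X ⊗ (c ⊙ R)) i j + (X ⊗ (d ⊙ T)) i j) (⊗-distribˡ-⊕ X (a ⊙ P) (b ⊙ Q) i j) ⟩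
    (X ⊗ (a ⊙ P)) i j + (X ⊗ (b ⊙ Q)) i j + (X ⊗ (c ⊙ R)) i j + (X ⊗ (d ⊙ T)) i j
      ≡⟨ cong₂ _+_ (cong₂ _+_ (cong₂ _+_ (⊗-⊙ a X P i j) (⊗-⊙ b X Q i j)) (⊗-⊙ c X R i j)) (⊗-⊙ d X T i j) ⟩
    a * (X ⊗ P) i j + b * (X ⊗ Q) i j + c * (X ⊗ R) i j + d * (X ⊗ T) i j
      ∎
    where open ≡-Reasoning

  square²≈scaled : ∀ {X Y a b} → X ⊗ X ⊕ Y ⊗ Y ≈ a ⊙ 𝐈 ⊕ b ⊙ 𝐉 → X ⊗ 𝐉 ≈ 𝟘 → X ⊗ Y ≈ 𝟘 →
                   (X ⊗ X) ⊗ (X ⊗ X) ≈ a ⊙ (X ⊗ X)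
  square²≈scaled {X} {Y} {a} {b} X²+Y²≈aI+bJ XJ≈𝟘 XY≈𝟘 i j = begin
    (X² ⊗ X²) i j                            ≡⟨ ZP.+-identityʳ _ ⟨
    (X² ⊗ X²) i j + 0ℤ                       ≡⟨ cong (_+_ ((X² ⊗ X²) i j)) (X²Y²≈𝟘 i j) ⟨
    (X² ⊗ X²) i j + (X² ⊗ Y²) i j            ≡⟨ ⊗-distribˡ-⊕ X² X² Y² i j ⟨
    (X² ⊗ (X² ⊕ Y²)) i j                     ≡⟨ ⊗-congʳ X² X²+Y²≈aI+bJ i j ⟩
    (X² ⊗ (a ⊙ 𝐈 ⊕ b ⊙ 𝐉)) i j               ≡⟨ ⊗-distribˡ-⊕ X² (a ⊙ 𝐈) (b ⊙ 𝐉) i j ⟩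
    (X² ⊗ (a ⊙ 𝐈)) i j + (X² ⊗ (b ⊙ 𝐉)) i j  ≡⟨ cong₂ _+_ (⊗-⊙ a X² 𝐈 i j) (⊗-⊙ b X² 𝐉 i j) ⟩
    a * (X² ⊗ 𝐈) i j + b * (X² ⊗ 𝐉) i j      ≡⟨ cong₂ (λ u v → a * u + b * v) (⊗-identityʳ X² i j) (X²J≈𝟘 i j) ⟩
    a * X² i j + b * 0ℤ                      ≡⟨ cong (_+_ (a * X² i j)) (ZP.*-zeroʳ b) ⟩
    a * X² i j + 0ℤ                          ≡⟨ ZP.+-identityʳ _ ⟩
    a * X² i j                               ∎
    where
    open ≡-Reasoning
    X² Y² : Matrix n
    X² = X ⊗ X
    Y² = Y ⊗ Y
    X²J≈𝟘 : X² ⊗ 𝐉 ≈ 𝟘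
    X²J≈𝟘 i j = trans (⊗-assoc X X 𝐉 i j) (⊗-zeroʳ X XJ≈𝟘 i j)
    XY²≈𝟘 : X ⊗ Y² ≈ 𝟘
    XY²≈𝟘 i j = trans (sym (⊗-assoc X Y Y i j)) (⊗-zeroˡ Y XY≈𝟘 i j)
    X²Y²≈𝟘 : X² ⊗ Y² ≈ 𝟘
    X²Y²≈𝟘 i j = trans (⊗-assoc X X Y² i j) (⊗-zeroʳ X XY²≈𝟘 i j)

  IsSymmetric IsSkewSymmetric : Matrix n → Set
  IsSymmetric X = ∀ i j → X j i ≡ X i j
  IsSkewSymmetric X = ∀ i j → X j i ≡ - X i j

  -- kept in ℕ, so that its nonnegativity comes for free
  rowNorm : Matrix n → Fin n → ℕ
  rowNorm X i = ∑ λ l → ∣ X i l ∣ ℕ.* ∣ X i l ∣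

  sum-squares≡rowNorm : ∀ X i → sum (λ l → X i l * X i l) ≡ + rowNorm X i
  sum-squares≡rowNorm X i =
    trans (sum-cong-≗ λ l → i*i≡+∣i∣*∣i∣ (X i l)) (sym (pos-∑ λ l → ∣ X i l ∣ ℕ.* ∣ X i l ∣))

  rowNorm≡0⇒row≡0 : ∀ X i → rowNorm X i ≡ 0 → ∀ l → X i l ≡ 0ℤ
  rowNorm≡0⇒row≡0 X i norm≡0 l with NP.m*n≡0⇒m≡0∨n≡0 ∣ X i l ∣ (∑≡0⇒≡0 _ norm≡0 l)
  ... | inj₁ ∣x∣≡0 = ZP.∣i∣≡0⇒i≡0 ∣x∣≡0
  ... | inj₂ ∣x∣≡0 = ZP.∣i∣≡0⇒i≡0 ∣x∣≡0

  square-diagonal : ∀ {X} → IsSymmetric X → ∀ i → (X ⊗ X) i i ≡ + rowNorm X i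
  square-diagonal {X} X-sym i =
    trans (sum-cong-≗ λ l → cong (X i l *_) (X-sym i l)) (sum-squares≡rowNorm X i)

  square-diagonal-skew : ∀ {X} → IsSkewSymmetric X → ∀ i → (X ⊗ X) i i ≡ - + rowNorm X i
  square-diagonal-skew {X} X-skew i = begin
    sum (λ l → X i l * X l i)     ≡⟨ sum-cong-≗ (λ l → trans (cong (X i l *_) (X-skew i l))
                                                           (sym (ZP.neg-distribʳ-* (X i l) (X i l)))) ⟩
    sum (λ l → - (X i l * X i l)) ≡⟨ sum-neg (λ l → X i l * X i l) ⟩
    - sum (λ l → X i l * X i l)   ≡⟨ cong -_ (sum-squares≡rowNorm X i) ⟩
    - + rowNorm X i               ∎
    where open ≡-Reasoning

  square-symmetric : ∀ {X} → IsSymmetric X → IsSymmetric (X ⊗ X)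
  square-symmetric {X} X-sym i j = sum-cong-≗ λ l →
    trans (cong₂ _*_ (X-sym l j) (X-sym i l)) (ZP.*-comm (X l j) (X i l))

  square-symmetric-skew : ∀ {X} → IsSkewSymmetric X → IsSymmetric (X ⊗ X)
  square-symmetric-skew {X} X-skew i j = sum-cong-≗ λ l → begin
    X j l * X l i         ≡⟨ cong₂ _*_ (X-skew l j) (X-skew i l) ⟩
    - X l j * - X i l     ≡⟨ ZP.neg-distribˡ-* (X l j) (- X i l) ⟨
    - (X l j * - X i l)   ≡⟨ cong -_ (ZP.neg-distribʳ-* (X l j) (X i l)) ⟨
    - - (X l j * X i l)   ≡⟨ ZP.neg-involutive _ ⟩
    X l j * X i l         ≡⟨ ZP.*-comm (X l j) (X i l) ⟩
    X i l * X l j         ∎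
    where open ≡-Reasoning

  rowNorm≡scale*diagonal : ∀ {Y a} → IsSymmetric Y → Y ⊗ Y ≈ a ⊙ Y → ∀ i → + rowNorm Y i ≡ a * Y i i
  rowNorm≡scale*diagonal Y-sym Y²≈aY i = trans (sym (square-diagonal Y-sym i)) (Y²≈aY i i)

-- Cayley graphs of normal subsets

lookup-≡-∈⇔ : ∀ {n} (S : Subset n) {x y} → (x ∈ S → y ∈ S) → (y ∈ S → x ∈ S) → lookup S x ≡ lookup S y
lookup-≡-∈⇔ S {x} {y} x⇒y y⇒x with lookup S x in Sx | lookup S y in Sy
... | true  | true  = refl
... | false | false = refl
... | true  | false = trans (sym ([]=⇒lookup (x⇒y (lookup⇒[]= x S Sx)))) Sy
... | false | true  = trans (sym Sx) ([]=⇒lookup (y⇒x (lookup⇒[]= y S Sy)))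

module _ {n} {_∙_ : Fin n → Fin n → Fin n} {e : Fin n} {_⁻¹ : Fin n → Fin n}
         (isGroup : IsGroup _≡_ _∙_ e _⁻¹) {S : Subset n}
         (S-normal : ∀ g s → s ∈ S → ((g ∙ s) ∙ (g ⁻¹)) ∈ S) where

  private
    group : Group _ _
    group = record { isGroup = isGroup }
    open Group group using (assoc; _\\_; _//_)
    open GroupProperties group

    A : Mat n
    A = cayley _∙_ _⁻¹ S

  unconjugate : ∀ g s → ((g ⁻¹) ∙ ((g ∙ s) // g)) // (g ⁻¹) ≡ s
  unconjugate g s = begin
    ((g ⁻¹) ∙ ((g ∙ s) // g)) // (g ⁻¹) ≡⟨ cong (((g ⁻¹) ∙ ((g ∙ s) // g)) ∙_) (⁻¹-involutive g) ⟩
    (g \\ ((g ∙ s) // g)) ∙ g           ≡⟨ cong (_∙ g) (assoc (g ⁻¹) (g ∙ s) (g ⁻¹)) ⟨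
    ((g \\ (g ∙ s)) // g) ∙ g           ≡⟨ //-rightDividesˡ g (g \\ (g ∙ s)) ⟩
    g \\ (g ∙ s)                        ≡⟨ \\-leftDividesʳ g s ⟩
    s                                   ∎
    where open ≡-Reasoning

  lookup-conjugate : ∀ g s → lookup S ((g ∙ s) // g) ≡ lookup S s
  lookup-conjugate g s = lookup-≡-∈⇔ S
    (λ gsg⁻¹∈S → subst (_∈ S) (unconjugate g s) (S-normal (g ⁻¹) _ gsg⁻¹∈S))
    (S-normal g s)

  twist : Fin n → Fin n → Fin n → Fin n
  twist i j l = i ∙ (l \\ j)

  twist⁻¹ : ∀ i j l → (twist i j l) ⁻¹ ≡ (j \\ l) // i
  twist⁻¹ i j l = trans (⁻¹-anti-homo-∙ i (l \\ j)) (cong (_∙ (i ⁻¹)) (⁻¹-anti-homo-\\ l j))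

  twist-inverse : ∀ i j m → twist i j (twist j i m) ≡ m
  twist-inverse i j m = begin
    i ∙ (((twist j i m) ⁻¹) ∙ j) ≡⟨ cong (λ x → i ∙ (x ∙ j)) (twist⁻¹ j i m) ⟩
    i ∙ (((i \\ m) // j) ∙ j)    ≡⟨ cong (i ∙_) (//-rightDividesˡ j (i \\ m)) ⟩
    i ∙ (i \\ m)                 ≡⟨ \\-leftDividesˡ i m ⟩
    m                            ∎
    where open ≡-Reasoning

  cayley-twistʳ : ∀ i j l → A (twist i j l) j ≡ A i l
  cayley-twistʳ i j l = cong (λ x → if lookup S x then 1 else 0) (begin
    j // twist i j l     ≡⟨ cong (j ∙_) (twist⁻¹ i j l) ⟩
    j ∙ ((j \\ l) // i)  ≡⟨ assoc j (j \\ l) (i ⁻¹) ⟨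
    (j ∙ (j \\ l)) // i  ≡⟨ cong (_// i) (\\-leftDividesˡ j l) ⟩
    l // i               ∎)
    where open ≡-Reasoning

  -- Normality of S enters only here: i (j⁻¹ l) i⁻¹ and l j⁻¹ = l (j⁻¹ l) l⁻¹ are both
  -- conjugates of j⁻¹ l.
  cayley-twistˡ : ∀ i j l → A (twist i j l) i ≡ A j l
  cayley-twistˡ i j l = cong (λ b → if b then 1 else 0) (begin
    lookup S (i // twist i j l)     ≡⟨ cong (λ x → lookup S (i ∙ x)) (twist⁻¹ i j l) ⟩
    lookup S (i ∙ ((j \\ l) // i))  ≡⟨ cong (lookup S) (assoc i (j \\ l) (i ⁻¹)) ⟨
    lookup S ((i ∙ (j \\ l)) // i)  ≡⟨ lookup-conjugate i (j \\ l) ⟩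
    lookup S (j \\ l)               ≡⟨ lookup-conjugate l (j \\ l) ⟨
    lookup S ((l ∙ (j \\ l)) // l)  ≡⟨ cong (lookup S) (assoc l (j \\ l) (l ⁻¹)) ⟩
    lookup S (l ∙ ((j \\ l) // l))  ≡⟨ cong (λ x → lookup S (l ∙ x)) (//-rightDividesʳ l (j ⁻¹)) ⟩
    lookup S (l // j)               ∎)
    where open ≡-Reasoning

  cayley-normal : ∀ i j → (A · A ᵀ) i j ≡ (A ᵀ · A) i j
  cayley-normal i j = begin
    ∑ (λ l → A i l ℕ.* A j l)
      ≡⟨ ∑-cong (λ l → cong₂ ℕ._*_ (cayley-twistʳ i j l) (cayley-twistˡ i j l)) ⟨
    ∑ (λ l → A (twist i j l) j ℕ.* A (twist i j l) i)
      ≡⟨ ∑-permute (λ m → A m j ℕ.* A m i) π ⟨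
    ∑ (λ m → A m j ℕ.* A m i)
      ≡⟨ ∑-cong (λ m → NP.*-comm (A m j) (A m i)) ⟩
    ∑ (λ m → A m i ℕ.* A m j)
      ∎
    where
    open ≡-Reasoning
    π : Permutation′ n
    π = permutation (twist i j) (twist j i) (twist-inverse i j) (twist-inverse j i)

-- Normal directed strongly regular graphs

module NormalDSRG {n} {A : Mat n} {k μ lam t : ℕ} (dsrg : IsDSRG n A k μ lam t)
                  (normal : ∀ i j → (A · A ᵀ) i j ≡ (A ᵀ · A) i j) where

  open IsDSRG dsrg

  τ c κ N ρ α : ℤ
  τ = + t - + μ
  c = + lam - + μ
  κ = + k
  N = + n
  ρ = κ + κ - c
  α = c * c + + 4 * τ

  𝐀 𝐌 : Matrix n
  𝐀 = toℤ A
  𝐌 = 𝐀 ⊗ 𝐀 ᵀ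

  diagonal-or-not : ∀ i j → (I i j ≡ 1 × A i j ≡ 0) ⊎ (I i j ≡ 0 × (A i j ≡ 0 ⊎ A i j ≡ 1))
  diagonal-or-not i j with i ≟ j
  ... | yes refl = inj₁ (refl , zeroDiag i)
  ... | no  _    = inj₂ (refl , zeroOne i j)

  arc⇒off-diagonal : ∀ {i j} → A i j ≡ 1 → I i j ≡ 0
  arc⇒off-diagonal {i} {j} Aij≡1 with i ≟ j
  ... | yes refl = ⊥-elim (NP.0≢1+n (trans (sym (zeroDiag i)) Aij≡1))
  ... | no  _    = refl

  𝐀⊗𝐀 : ∀ i j → (𝐀 ⊗ 𝐀) i j ≡ τ * 𝐈 i j + c * 𝐀 i j + + μ
  𝐀⊗𝐀 i j = begin
    (𝐀 ⊗ 𝐀) i j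
      ≡⟨ toℤ-· A A i j ⟨
    + (A · A) i j
      ≡⟨ cong +_ (A² i j) ⟩
    + (t ℕ.* I i j ℕ.+ lam ℕ.* A i j ℕ.+ μ ℕ.* (1 ℕ.∸ I i j ℕ.∸ A i j))
      ≡⟨ pos-linear₃ t lam μ (I i j) (A i j) _ ⟩
    + t * δ + + lam * a + + μ * + (1 ℕ.∸ I i j ℕ.∸ A i j)
      ≡⟨ cong (λ z → + t * δ + + lam * a + + μ * z) (1∸δ∸a≡1-δ-a (diagonal-or-not i j)) ⟩
    + t * δ + + lam * a + + μ * (1ℤ - δ - a)
      ≡⟨ rearrange (+ t) (+ lam) (+ μ) δ a ⟩
    τ * δ + c * a + + μ
      ∎
    where
    open ≡-Reasoning
    δ a : ℤ
    δ = 𝐈 i j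
    a = 𝐀 i j
    rearrange : ∀ t l u δ a → t * δ + l * a + u * (1ℤ - δ - a) ≡ (t - u) * δ + (l - u) * a + u
    rearrange = solve-∀

  𝐀ᵀ⊗𝐀ᵀ : ∀ i j → (𝐀 ᵀ ⊗ 𝐀 ᵀ) i j ≡ τ * 𝐈 i j + c * 𝐀 j i + + μ
  𝐀ᵀ⊗𝐀ᵀ i j = begin
    (𝐀 ᵀ ⊗ 𝐀 ᵀ) i j             ≡⟨ ⊗-transpose 𝐀 𝐀 i j ⟨
    (𝐀 ⊗ 𝐀) j i                 ≡⟨ 𝐀⊗𝐀 j i ⟩
    τ * 𝐈 j i + c * 𝐀 j i + + μ ≡⟨ cong (λ d → τ * + d + c * 𝐀 j i + + μ) (I-sym j i) ⟩
    τ * 𝐈 i j + c * 𝐀 j i + + μ ∎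
    where open ≡-Reasoning

  𝐀ᵀ⊗𝐀 : ∀ i j → (𝐀 ᵀ ⊗ 𝐀) i j ≡ 𝐌 i j
  𝐀ᵀ⊗𝐀 i j = trans (sym (toℤ-· (A ᵀ) A i j)) (trans (cong +_ (sym (normal i j))) (toℤ-· A (A ᵀ) i j))

  𝐀⊗𝐉 : ∀ i j → (𝐀 ⊗ 𝐉) i j ≡ κ
  𝐀⊗𝐉 i j = trans (sym (toℤ-· A J i j)) (cong +_ (trans (AJ≡kJ i j) (NP.*-identityʳ k)))

  𝐉⊗𝐀 : ∀ i j → (𝐉 ⊗ 𝐀) i j ≡ κ
  𝐉⊗𝐀 i j = trans (sym (toℤ-· J A i j)) (cong +_ (trans (JA≡kJ i j) (NP.*-identityʳ k)))

  𝐀ᵀ⊗𝐉 : ∀ i j → (𝐀 ᵀ ⊗ 𝐉) i j ≡ κ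
  𝐀ᵀ⊗𝐉 i j = trans (sym (⊗-transpose 𝐉 𝐀 i j)) (𝐉⊗𝐀 j i)

  𝐉⊗𝐀ᵀ : ∀ i j → (𝐉 ⊗ 𝐀 ᵀ) i j ≡ κ
  𝐉⊗𝐀ᵀ i j = trans (sym (⊗-transpose 𝐀 𝐉 i j)) (𝐀⊗𝐉 j i)

  𝐉⊗𝐉 : ∀ i j → (𝐉 ⊗ 𝐉) i j ≡ N
  𝐉⊗𝐉 i j = trans (sym (toℤ-· (J {n}) J i j)) (cong +_ (∑-ones n))

  ⟦_,_,_,_⟧ : ℤ → ℤ → ℤ → ℤ → Matrix n
  ⟦ x , y , z , w ⟧ = x ⊙ 𝐀 ⊕ y ⊙ 𝐀 ᵀ ⊕ z ⊙ 𝐈 ⊕ w ⊙ 𝐉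

  private
    comb-cong : ∀ x y z w {p p′ q q′ r r′ s s′} → p ≡ p′ → q ≡ q′ → r ≡ r′ → s ≡ s′ →
                x * p + y * q + z * r + w * s ≡ x * p′ + y * q′ + z * r′ + w * s′
    comb-cong x y z w refl refl refl refl = refl

  𝐀⊗⟦⟧ : ∀ x y z w i j → (𝐀 ⊗ ⟦ x , y , z , w ⟧) i j ≡
         x * (τ * 𝐈 i j + c * 𝐀 i j + + μ) + y * 𝐌 i j + z * 𝐀 i j + w * κ
  𝐀⊗⟦⟧ x y z w i j = trans (⊗-comb x y z w 𝐀 (𝐀 ᵀ) 𝐈 𝐉 𝐀 i j)
    (comb-cong x y z w (𝐀⊗𝐀 i j) refl (⊗-identityʳ 𝐀 i j) (𝐀⊗𝐉 i j))

  𝐀ᵀ⊗⟦⟧ : ∀ x y z w i j → (𝐀 ᵀ ⊗ ⟦ x , y , z , w ⟧) i j ≡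
          x * 𝐌 i j + y * (τ * 𝐈 i j + c * 𝐀 j i + + μ) + z * 𝐀 j i + w * κ
  𝐀ᵀ⊗⟦⟧ x y z w i j = trans (⊗-comb x y z w 𝐀 (𝐀 ᵀ) 𝐈 𝐉 (𝐀 ᵀ) i j)
    (comb-cong x y z w (𝐀ᵀ⊗𝐀 i j) (𝐀ᵀ⊗𝐀ᵀ i j) (⊗-identityʳ (𝐀 ᵀ) i j) (𝐀ᵀ⊗𝐉 i j))

  𝐉⊗⟦⟧ : ∀ x y z w i j → (𝐉 ⊗ ⟦ x , y , z , w ⟧) i j ≡ x * κ + y * κ + z * 1ℤ + w * N
  𝐉⊗⟦⟧ x y z w i j = trans (⊗-comb x y z w 𝐀 (𝐀 ᵀ) 𝐈 𝐉 𝐉 i j)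
    (comb-cong x y z w (𝐉⊗𝐀 i j) (𝐉⊗𝐀ᵀ i j) (⊗-identityʳ 𝐉 i j) (𝐉⊗𝐉 i j))

  ⟦⟧⊗𝐉 : ∀ x y z w i j → (⟦ x , y , z , w ⟧ ⊗ 𝐉) i j ≡ x * κ + y * κ + z * 1ℤ + w * N
  ⟦⟧⊗𝐉 x y z w i j = trans (comb-⊗ x y z w 𝐀 (𝐀 ᵀ) 𝐈 𝐉 𝐉 i j)
    (comb-cong x y z w (𝐀⊗𝐉 i j) (𝐀ᵀ⊗𝐉 i j) (⊗-identityˡ 𝐉 i j) (𝐉⊗𝐉 i j))

  ⟦⟧⊗⟦⟧ : ∀ x y z w x′ y′ z′ w′ i j → (⟦ x , y , z , w ⟧ ⊗ ⟦ x′ , y′ , z′ , w′ ⟧) i j ≡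
          (c * x * x′ + x * z′ + z * x′) * 𝐀 i j
          + (c * y * y′ + y * z′ + z * y′) * 𝐀 j i
          + (τ * (x * x′ + y * y′) + z * z′) * 𝐈 i j
          + (+ μ * (x * x′ + y * y′) + κ * ((x + y) * w′ + w * (x′ + y′)) + z * w′ + w * z′ + N * w * w′)
          + (x * y′ + y * x′) * 𝐌 i j
  ⟦⟧⊗⟦⟧ x y z w x′ y′ z′ w′ i j = begin
    (⟦ x , y , z , w ⟧ ⊗ V) i j
      ≡⟨ comb-⊗ x y z w 𝐀 (𝐀 ᵀ) 𝐈 𝐉 V i j ⟩
    x * (𝐀 ⊗ V) i j + y * (𝐀 ᵀ ⊗ V) i j + z * (𝐈 ⊗ V) i j + w * (𝐉 ⊗ V) i j
      ≡⟨ comb-cong x y z w (𝐀⊗⟦⟧ x′ y′ z′ w′ i j) (𝐀ᵀ⊗⟦⟧ x′ y′ z′ w′ i j)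
                           (⊗-identityˡ V i j) (𝐉⊗⟦⟧ x′ y′ z′ w′ i j) ⟩
    x * (x′ * (τ * δ + c * a + + μ) + y′ * m + z′ * a + w′ * κ)
      + y * (x′ * m + y′ * (τ * δ + c * b + + μ) + z′ * b + w′ * κ)
      + z * (x′ * a + y′ * b + z′ * δ + w′ * 1ℤ)
      + w * (x′ * κ + y′ * κ + z′ * 1ℤ + w′ * N)
      ≡⟨ collect τ c (+ μ) κ N a b δ m x y z w x′ y′ z′ w′ ⟩
    (c * x * x′ + x * z′ + z * x′) * a
      + (c * y * y′ + y * z′ + z * y′) * b
      + (τ * (x * x′ + y * y′) + z * z′) * δ
      + (+ μ * (x * x′ + y * y′) + κ * ((x + y) * w′ + w * (x′ + y′)) + z * w′ + w * z′ + N * w * w′)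
      + (x * y′ + y * x′) * m
      ∎
    where
    open ≡-Reasoning
    V : Matrix n
    V = ⟦ x′ , y′ , z′ , w′ ⟧
    a b δ m : ℤ
    a = 𝐀 i j
    b = 𝐀 j i
    δ = 𝐈 i j
    m = 𝐌 i j
    collect : ∀ τ c u κ N a b δ m x y z w x′ y′ z′ w′ →
      x * (x′ * (τ * δ + c * a + u) + y′ * m + z′ * a + w′ * κ)
        + y * (x′ * m + y′ * (τ * δ + c * b + u) + z′ * b + w′ * κ)
        + z * (x′ * a + y′ * b + z′ * δ + w′ * 1ℤ)
        + w * (x′ * κ + y′ * κ + z′ * 1ℤ + w′ * N)
      ≡ (c * x * x′ + x * z′ + z * x′) * a
        + (c * y * y′ + y * z′ + z * y′) * b
        + (τ * (x * x′ + y * y′) + z * z′) * δ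
        + (u * (x * x′ + y * y′) + κ * ((x + y) * w′ + w * (x′ + y′)) + z * w′ + w * z′ + N * w * w′)
        + (x * y′ + y * x′) * m
    collect = solve-∀

  𝐃 : ℤ → Matrix n
  𝐃 x = ⟦ x , - x , 0ℤ , 0ℤ ⟧

  𝐏 : ℤ → ℤ → Matrix n
  𝐏 y w = ⟦ y , y , - (c * y) , w ⟧

  -- In the following identities the left-hand side of the polynomial identity in the
  -- where-clause is the formula of ⟦⟧⊗⟦⟧ at the coefficients of the two factors.

  𝐃⊗𝐏 : ∀ x y w → 𝐃 x ⊗ 𝐏 y w ≈ 𝟘
  𝐃⊗𝐏 x y w i j = trans (⟦⟧⊗⟦⟧ x (- x) 0ℤ 0ℤ y y (- (c * y)) w i j)
                        (vanishes τ c (+ μ) κ N (𝐀 i j) (𝐀 j i) (𝐈 i j) (𝐌 i j) x y w)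
    where
    vanishes : ∀ τ c u κ N a b δ m x y w →
        (c * x * y + x * (- (c * y)) + 0ℤ * y) * a
        + (c * (- x) * y + (- x) * (- (c * y)) + 0ℤ * y) * b
        + (τ * (x * y + (- x) * y) + 0ℤ * (- (c * y))) * δ
        + (u * (x * y + (- x) * y) + κ * ((x + (- x)) * w + 0ℤ * (y + y))
           + 0ℤ * w + 0ℤ * (- (c * y)) + N * 0ℤ * w)
        + (x * y + (- x) * y) * m
        ≡ 0ℤ
    vanishes = solve-∀

  𝐏⊗𝐃 : ∀ y w x → 𝐏 y w ⊗ 𝐃 x ≈ 𝟘
  𝐏⊗𝐃 y w x i j = trans (⟦⟧⊗⟦⟧ y y (- (c * y)) w x (- x) 0ℤ 0ℤ i j)
                        (vanishes τ c (+ μ) κ N (𝐀 i j) (𝐀 j i) (𝐈 i j) (𝐌 i j) x y w)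
    where
    vanishes : ∀ τ c u κ N a b δ m x y w →
        (c * y * x + y * 0ℤ + (- (c * y)) * x) * a
        + (c * y * (- x) + y * 0ℤ + (- (c * y)) * (- x)) * b
        + (τ * (y * x + y * (- x)) + (- (c * y)) * 0ℤ) * δ
        + (u * (y * x + y * (- x)) + κ * ((y + y) * 0ℤ + w * (x + (- x)))
           + (- (c * y)) * 0ℤ + w * 0ℤ + N * w * 0ℤ)
        + (y * (- x) + y * x) * m
        ≡ 0ℤ
    vanishes = solve-∀

  𝐃⊗𝐉 : ∀ x → 𝐃 x ⊗ 𝐉 ≈ 𝟘
  𝐃⊗𝐉 x i j = trans (⟦⟧⊗𝐉 x (- x) 0ℤ 0ℤ i j) (vanishes κ N x)
    where
    vanishes : ∀ κ N x → x * κ + (- x) * κ + 0ℤ * 1ℤ + 0ℤ * N ≡ 0ℤ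
    vanishes = solve-∀

  𝐏⊗𝐉 : ∀ y w i j → (𝐏 y w ⊗ 𝐉) i j ≡ y * ρ + w * N
  𝐏⊗𝐉 y w i j = trans (⟦⟧⊗𝐉 y y (- (c * y)) w i j) (rearrange κ N c y w)
    where
    rearrange : ∀ κ N c y w → y * κ + y * κ + (- (c * y)) * 1ℤ + w * N ≡ y * (κ + κ - c) + w * N
    rearrange = solve-∀

  β : ℤ → ℤ → ℤ
  β x w = + 4 * + μ * (x * x) + + 2 * ρ * x * w + N * w * w

  𝐃²+𝐏² : ∀ x w → 𝐃 x ⊗ 𝐃 x ⊕ 𝐏 x w ⊗ 𝐏 x w ≈ (α * (x * x)) ⊙ 𝐈 ⊕ β x w ⊙ 𝐉
  𝐃²+𝐏² x w i j = trans (cong₂ _+_ (⟦⟧⊗⟦⟧ x (- x) 0ℤ 0ℤ x (- x) 0ℤ 0ℤ i j)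
                                   (⟦⟧⊗⟦⟧ x x (- (c * x)) w x x (- (c * x)) w i j))
                        (rearrange τ c (+ μ) κ N (𝐀 i j) (𝐀 j i) (𝐈 i j) (𝐌 i j) x w)
    where
    rearrange : ∀ τ c u κ N a b δ m x w →
        ((c * x * x + x * 0ℤ + 0ℤ * x) * a
         + (c * (- x) * (- x) + (- x) * 0ℤ + 0ℤ * (- x)) * b
         + (τ * (x * x + (- x) * (- x)) + 0ℤ * 0ℤ) * δ
         + (u * (x * x + (- x) * (- x)) + κ * ((x + (- x)) * 0ℤ + 0ℤ * (x + (- x)))
            + 0ℤ * 0ℤ + 0ℤ * 0ℤ + N * 0ℤ * 0ℤ)
         + (x * (- x) + (- x) * x) * m)
        + ((c * x * x + x * (- (c * x)) + (- (c * x)) * x) * a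
         + (c * x * x + x * (- (c * x)) + (- (c * x)) * x) * b
         + (τ * (x * x + x * x) + (- (c * x)) * (- (c * x))) * δ
         + (u * (x * x + x * x) + κ * ((x + x) * w + w * (x + x))
            + (- (c * x)) * w + w * (- (c * x)) + N * w * w)
         + (x * x + x * x) * m)
        ≡ ((c * c + + 4 * τ) * (x * x)) * δ + (+ 4 * u * (x * x) + + 2 * (κ + κ - c) * x * w + N * w * w) * 1ℤ
    rearrange = solve-∀

  𝐃-skew : ∀ x → IsSkewSymmetric (𝐃 x)
  𝐃-skew x i j = antisymmetry x (𝐀 i j) (𝐀 j i) (𝐈 j i) (𝐈 i j)
    where
    antisymmetry : ∀ x a b δ′ δ →
                   x * b + (- x) * a + 0ℤ * δ′ + 0ℤ * 1ℤ ≡ - (x * a + (- x) * b + 0ℤ * δ + 0ℤ * 1ℤ)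
    antisymmetry = solve-∀

  𝐏-sym : ∀ y w → IsSymmetric (𝐏 y w)
  𝐏-sym y w i j = begin
    y * b + y * a + (- (c * y)) * + I j i + w * 1ℤ
      ≡⟨ cong (λ d → y * b + y * a + (- (c * y)) * + d + w * 1ℤ) (I-sym j i) ⟩
    y * b + y * a + (- (c * y)) * + I i j + w * 1ℤ
      ≡⟨ cong (λ u → u + (- (c * y)) * + I i j + w * 1ℤ) (ZP.+-comm (y * b) (y * a)) ⟩
    y * a + y * b + (- (c * y)) * + I i j + w * 1ℤ
      ∎
    where
    open ≡-Reasoning
    a b : ℤ
    a = 𝐀 i j
    b = 𝐀 j i

  -- 𝐐 = nP − ρJ = P (nI − J), i.e. P followed by n times the projection onto the
  -- orthogonal complement of the all-ones vector.
  𝐐 : Matrix n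
  𝐐 = 𝐏 N (- ρ)

  𝐐⊗𝐉 : 𝐐 ⊗ 𝐉 ≈ 𝟘
  𝐐⊗𝐉 i j = trans (𝐏⊗𝐉 N (- ρ) i j) (cancel N ρ)
    where
    cancel : ∀ N ρ → N * ρ + (- ρ) * N ≡ 0ℤ
    cancel = solve-∀

  module _ (e : Fin n) where

    t≡∑ : ∑ (λ l → A e l ℕ.* A l e) ≡ t
    t≡∑ = begin
      ∑ (λ l → A e l ℕ.* A l e)
        ≡⟨ A² e e ⟩
      t ℕ.* I e e ℕ.+ lam ℕ.* A e e ℕ.+ μ ℕ.* (1 ℕ.∸ I e e ℕ.∸ A e e)
        ≡⟨ cong₂ (λ d a → t ℕ.* d ℕ.+ lam ℕ.* a ℕ.+ μ ℕ.* (1 ℕ.∸ d ℕ.∸ a)) (I-diag e) (zeroDiag e) ⟩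
      t ℕ.* 1 ℕ.+ lam ℕ.* 0 ℕ.+ μ ℕ.* 0
        ≡⟨ simplify t lam μ ⟩
      t
        ∎
      where
      open ≡-Reasoning
      simplify : ∀ t l u → t ℕ.* 1 ℕ.+ l ℕ.* 0 ℕ.+ u ℕ.* 0 ≡ t
      simplify = ℕ-Solver.solve-∀

    k≡∑ : ∑ (λ l → A e l ℕ.* 1) ≡ k
    k≡∑ = trans (AJ≡kJ e e) (NP.*-identityʳ k)

    reciprocated-arc : 0 < t → ∃ λ w → A e w ≡ 1 × A w e ≡ 1
    reciprocated-arc 0<t with 0<∑⇒∃0< (λ l → A e l ℕ.* A l e) (subst (0 <_) (sym t≡∑) 0<t)
    ... | w , 0<AewAwe = w , 0<x*y⇒x≡1×y≡1 (zeroOne e w) (zeroOne w e) 0<AewAwe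

    unreciprocated-arc : t < k → ∃ λ z → A e z ≡ 1 × A z e ≡ 0
    unreciprocated-arc t<k with ∑<∑⇒∃< (λ l → A e l ℕ.* A l e) (λ l → A e l ℕ.* 1)
                                  (λ l → x*y≤x*1 (A e l) (zeroOne l e)) (subst₂ _<_ (sym t≡∑) (sym k≡∑) t<k)
    ... | z , AezAze<Aez = z , x*y<x*1⇒x≡1×y≡0 (zeroOne e z) (zeroOne z e) AezAze<Aez

    α≤0 : ∀ {z} → A e z ≡ 1 → A z e ≡ 0 → α ℤ.≤ 0ℤ
    α≤0 {z} Aez≡1 Aze≡0 = subst (ℤ._≤ 0ℤ) (ZP.*-identityʳ α) (*-neg≥0⇒≤0 (α * 1ℤ) 0<‖D‖ ‖D²‖≡α‖D‖)
      where
      D : Matrix n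
      D = 𝐃 1ℤ
      D⁴ : (D ⊗ D) ⊗ (D ⊗ D) ≈ (α * 1ℤ) ⊙ (D ⊗ D)
      D⁴ = square²≈scaled {X = D} {Y = 𝐏 1ℤ 0ℤ} {a = α * 1ℤ} {b = β 1ℤ 0ℤ}
             (𝐃²+𝐏² 1ℤ 0ℤ) (𝐃⊗𝐉 1ℤ) (𝐃⊗𝐏 1ℤ 1ℤ 0ℤ)
      ‖D²‖≡α‖D‖ : + rowNorm (D ⊗ D) e ≡ α * 1ℤ * - + rowNorm D e
      ‖D²‖≡α‖D‖ = trans (rowNorm≡scale*diagonal {a = α * 1ℤ} (square-symmetric-skew (𝐃-skew 1ℤ)) D⁴ e)
                        (cong (α * 1ℤ *_) (square-diagonal-skew (𝐃-skew 1ℤ) e))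
      Dez≡1 : D e z ≡ 1ℤ
      Dez≡1 = cong₂ (λ p q → 1ℤ * + p + - 1ℤ * + q + 0ℤ * 𝐈 e z + 0ℤ * 1ℤ) Aez≡1 Aze≡0
      0<‖D‖ : 0 < rowNorm D e
      0<‖D‖ = NP.≤-trans (NP.≤-reflexive (cong (λ d → ∣ d ∣ ℕ.* ∣ d ∣) (sym Dez≡1)))
                         (term≤∑ (λ l → ∣ D e l ∣ ℕ.* ∣ D e l ∣) z)

    𝐐-row≡0 : α ℤ.≤ 0ℤ → ∀ l → 𝐐 e l ≡ 0ℤ
    𝐐-row≡0 α≤0 = rowNorm≡0⇒row≡0 𝐐 e (ZP.+-injective ‖Q‖≡0)
      where
      Q⁴ : (𝐐 ⊗ 𝐐) ⊗ (𝐐 ⊗ 𝐐) ≈ (α * (N * N)) ⊙ (𝐐 ⊗ 𝐐)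
      Q⁴ = square²≈scaled {X = 𝐐} {Y = 𝐃 N} {a = α * (N * N)} {b = β N (- ρ)}
             (λ i j → trans (⊕-comm (𝐐 ⊗ 𝐐) (𝐃 N ⊗ 𝐃 N) i j) (𝐃²+𝐏² N (- ρ) i j)) 𝐐⊗𝐉 (𝐏⊗𝐃 N (- ρ) N)
      ‖Q²‖≡0 : rowNorm (𝐐 ⊗ 𝐐) e ≡ 0
      ‖Q²‖≡0 = ≤0*+≡+⇒≡0 (≤0*square≤0 N α≤0)
                 (trans (rowNorm≡scale*diagonal {a = α * (N * N)} (square-symmetric (𝐏-sym N (- ρ))) Q⁴ e)
                        (cong (α * (N * N) *_) (square-diagonal (𝐏-sym N (- ρ)) e)))
      ‖Q‖≡0 : + rowNorm 𝐐 e ≡ 0ℤ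
      ‖Q‖≡0 = trans (sym (square-diagonal (𝐏-sym N (- ρ)) e)) (rowNorm≡0⇒row≡0 (𝐐 ⊗ 𝐐) e ‖Q²‖≡0 e)

    𝐐-entry : ∀ {j a b d} → A e j ≡ a → A j e ≡ b → I e j ≡ d →
              𝐐 e j ≡ N * + a + N * + b + (- (c * N)) * + d + (- ρ) * 1ℤ
    𝐐-entry refl refl refl = refl

    n≡0 : 0 < t → t < k → n ≡ 0
    n≡0 0<t t<k with reciprocated-arc 0<t | unreciprocated-arc t<k
    ... | w , Aew≡1 , Awe≡1 | z , Aez≡1 , Aze≡0 = ZP.+-injective (begin
      N                                                    ≡⟨ difference N c ρ ⟩
      (N * 1ℤ + N * 1ℤ + (- (c * N)) * 0ℤ + (- ρ) * 1ℤ)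
        - (N * 1ℤ + N * 0ℤ + (- (c * N)) * 0ℤ + (- ρ) * 1ℤ) ≡⟨ cong₂ _-_ (𝐐-entry Aew≡1 Awe≡1 (arc⇒off-diagonal Aew≡1))
                                                                      (𝐐-entry Aez≡1 Aze≡0 (arc⇒off-diagonal Aez≡1)) ⟨
      𝐐 e w - 𝐐 e z                                        ≡⟨ cong₂ _-_ (𝐐-row≡0 α≤0′ w) (𝐐-row≡0 α≤0′ z) ⟩
      0ℤ                                                   ∎)
      where
      open ≡-Reasoning
      α≤0′ : α ℤ.≤ 0ℤ
      α≤0′ = α≤0 Aez≡1 Aze≡0
      difference : ∀ N c ρ → N ≡ (N * 1ℤ + N * 1ℤ + (- (c * N)) * 0ℤ + (- ρ) * 1ℤ)
                                 - (N * 1ℤ + N * 0ℤ + (- (c * N)) * 0ℤ + (- ρ) * 1ℤ)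
      difference = solve-∀

  no-normal-DSRG : Fin n → 0 < t → t < k → ⊥
  no-normal-DSRG e 0<t t<k = ¬Fin0 (subst Fin (n≡0 e 0<t t<k) e)

-- The hypothesis e ∉ S only says that the diagonal of A vanishes, which IsDSRG already records.
mainTheorem2 : (n : ℕ) (_∙_ : Fin n → Fin n → Fin n) (e : Fin n) (_⁻¹ : Fin n → Fin n) →
    IsGroup _≡_ _∙_ e _⁻¹ →
    (S : Subset n) → e ∉ S →
    (∀ g s → s ∈ S → ((g ∙ s) ∙ (g ⁻¹)) ∈ S) →
    (k μ lam t : ℕ) →
    ¬ (IsDSRG n (cayley _∙_ _⁻¹ S) k μ lam t × 0 < t × t < k)
mainTheorem2 n _∙_ e _⁻¹ isGroup S _ S-normal k μ lam t (dsrg , 0<t , t<k) =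
  NormalDSRG.no-normal-DSRG dsrg (cayley-normal isGroup S-normal) e 0<t t<k
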